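{- Let $m\geq 1$ and $n>2m+1$ be integers. Let $G_m$ be the graph with vertex set $\mathbb Z_{2m}$ and edges $\{i,i+1\}$ for $1\leq i<2m-1$ and $\{0,i\}$ for $1\leq i<2m$. For $m\leq i\leq 2m-1$, let $H_i$ be the parallel connection of $G_m$ with the $n$-cycle $C_n$ along the edge $\{0,i\}$, i.e. the graph obtained from $G_m$ by adding a new path of length $n-1$ (with $n-2$ new internal vertices) joining the vertices $0$ and $i$. Then the graphs $H_m,H_{m+1},\dots,H_{2m-1}$ are mutually non-isomorphic. -}

module Defs where

open import Data.Nat using (ℕ; zero; suc; _+_; _*_; _∸_; _<_; _≤_)
open import Data.Nat.Properties using (_≟_; _<?_; _≤?_)
open import Data.Bool using (Bool; true; false; _∧_; _∨_)
open import Data.Fin using (Fin; toℕ)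
open import Data.Product using (_×_)
open import Function.Bundles using (_↔_; Inverse)
open import Relation.Binary.PropositionalEquality using (_≡_)
open import Relation.Nullary.Decidable using (⌊_⌋)

record Graph (N : ℕ) : Set₁ where
  field
    Adj : Fin N → Fin N → Set

open Graph public

record _≅_ {N M : ℕ} (G : Graph N) (H : Graph M) : Set where
  field
    bij     : Fin N ↔ Fin M
    preserves : ∀ u v → Adj G u v → Adj H (Inverse.to bij u) (Inverse.to bij v)
    reflects  : ∀ u v → Adj H (Inverse.to bij u) (Inverse.to bij v) → Adj G u v

-- Directed "edge generators" on natural-number labels (made symmetric below).
-- G_m on {0,…,2m-1}: edges {j,j+1} for 1 ≤ j < 2m-1, and {0,j} for 1 ≤ j < 2m.
gEdge : ℕ → ℕ → ℕ → Bool
gEdge m a b =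
  (⌊ 1 ≤? a ⌋ ∧ ⌊ a <? 2 * m ∸ 1 ⌋ ∧ ⌊ b ≟ suc a ⌋)
  ∨ (⌊ a ≟ 0 ⌋ ∧ ⌊ 1 ≤? b ⌋ ∧ ⌊ b <? 2 * m ⌋)

-- H_{m,n,i}: vertices 0,…,2m-1 (those of G_m) and new vertices
-- 2m, …, 2m+n-3 (the n-2 internal vertices of the new path).
-- New path: 0 — 2m — 2m+1 — … — 2m+n-3 — i   (n-1 edges).
pathEdge : ℕ → ℕ → ℕ → ℕ → ℕ → Bool
pathEdge m n i a b =
  (⌊ a ≟ 0 ⌋ ∧ ⌊ b ≟ 2 * m ⌋)
  ∨ (⌊ 2 * m ≤? a ⌋ ∧ ⌊ suc a <? 2 * m + (n ∸ 2) ⌋ ∧ ⌊ b ≟ suc a ⌋)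
  ∨ (⌊ a ≟ 2 * m + (n ∸ 2) ∸ 1 ⌋ ∧ ⌊ b ≟ i ⌋)

hEdge : ℕ → ℕ → ℕ → ℕ → ℕ → Bool
hEdge m n i a b = gEdge m a b ∨ pathEdge m n i a b

H : (m n i : ℕ) → Graph (2 * m + (n ∸ 2))
H m n i .Adj u v = (hEdge m n i (toℕ u) (toℕ v) ∨ hEdge m n i (toℕ v) (toℕ u)) ≡ true

{-# OPTIONS --safe #-}
-- In H_i the vertices lying on a triangle are exactly those of G_m: the new path closes a
-- cycle of length n ≥ 4 and creates no triangle. Among them the hubs, adjacent to all other
-- triangle vertices, are 0 (and 2 when m = 2); the remaining rim vertices lie on the path
-- 1, …, 2m−1, and the only rim vertex with a neighbour outside every triangle is i. These
-- notions are isomorphism invariant, hence so is the property "the attached rim vertex is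
-- joined to an end of the rim by at most k steps along rim vertices". In H_j it holds for
-- k = 2m−1−j, while in H_i, m ≤ i < j, the vertex i is more than k steps from both ends.
module Submission where

open import Defs
open import Data.Nat using (ℕ; _+_; _*_; _∸_; _<_; _≤_)
open import Relation.Binary.PropositionalEquality using (_≡_)
open import Relation.Nullary using (¬_)

open import Data.Bool.Base using (_∨_)
open import Data.Empty using (⊥-elim)
open import Data.Fin.Base using (Fin; toℕ; fromℕ<)
open import Data.Fin.Properties using (toℕ-fromℕ<; toℕ<n; toℕ-injective)
open import Data.Nat.Base using (zero; suc; pred; z≤n; s≤s; s≤s⁻¹; NonZero; >-nonZero)
open import Data.Nat.Properties
open import Data.Product.Base using (∃; ∃₂; _×_; _,_; proj₁; proj₂)
open import Data.Sum.Base using (_⊎_; inj₁; inj₂; swap)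
import Data.Sum.Base as Sum
open import Function.Base using (_∘_)
open import Function.Bundles using (Inverse)
open import Function.Construct.Identity using (↔-id)
open import Function.Construct.Symmetry using (↔-sym)
open import Relation.Binary.Definitions using (tri<; tri≈; tri>)
open import Relation.Binary.PropositionalEquality
  using (_≢_; refl; sym; trans; cong; subst; subst₂)
open import Relation.Nullary.Decidable using (Dec; yes; no; ⌊_⌋)
open import Relation.Nullary.Reflects
  using (Reflects; ofʸ; ofⁿ; invert; det; _×-reflects_; _⊎-reflects_)

private variable
  a b k x y z : ℕ

module _ {N N′ : ℕ} {G : Graph N} {G′ : Graph N′} where

  ⟦_⟧ : G ≅ G′ → Fin N → Fin N′
  ⟦ φ ⟧ = Inverse.to (_≅_.bij φ)

  ≅-sym : G ≅ G′ → G′ ≅ G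
  ≅-sym φ = record
    { bij       = ↔-sym bij
    ; preserves = λ u v uv → reflects (from u) (from v)
        (subst₂ (Adj G′) (sym (strictlyInverseˡ u)) (sym (strictlyInverseˡ v)) uv)
    ; reflects  = λ u v uv → subst₂ (Adj G′) (strictlyInverseˡ u) (strictlyInverseˡ v)
        (preserves (from u) (from v) uv)
    }
    where
    open _≅_ φ
    open Inverse bij using (from; strictlyInverseˡ)

VertexProperty : Set₁
VertexProperty = ∀ {N} → Graph N → Fin N → Set

Invariant : VertexProperty → Set₁
Invariant P = ∀ {N N′} {G : Graph N} {G′ : Graph N′} (φ : G ≅ G′) {v} → P G v → P G′ (⟦ φ ⟧ v)

module _ {N N′ : ℕ} {G : Graph N} {G′ : Graph N′} (φ : G ≅ G′) where

  open Inverse (_≅_.bij φ) using (from; strictlyInverseˡ; strictlyInverseʳ)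

  ≅-preserves : ∀ {u v} → Adj G u v → Adj G′ (⟦ φ ⟧ u) (⟦ φ ⟧ v)
  ≅-preserves = _≅_.preserves φ _ _

  ≅-reflects : ∀ {u v} → Adj G′ (⟦ φ ⟧ u) (⟦ φ ⟧ v) → Adj G u v
  ≅-reflects = _≅_.reflects φ _ _

  reflect : {P : VertexProperty} → Invariant P → ∀ {v} → P G′ (⟦ φ ⟧ v) → P G v
  reflect {P} P-invariant {v} p = subst (P G) (strictlyInverseʳ v) (P-invariant (≅-sym φ) p)

  onto : {Q : Fin N′ → Set} → (∀ v → Q (⟦ φ ⟧ v)) → ∀ v′ → Q v′
  onto {Q} q v′ = subst Q (strictlyInverseˡ v′) (q (from v′))

module _ {N : ℕ} (G : Graph N) where

  InTriangle : Fin N → Set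
  InTriangle v = ∃₂ λ a b → Adj G v a × Adj G v b × Adj G a b

  IsHub : Fin N → Set
  IsHub v = InTriangle v × (∀ w → InTriangle w → w ≢ v → Adj G v w)

  IsRim : Fin N → Set
  IsRim v = InTriangle v × ¬ IsHub v

  IsAttachment : Fin N → Set
  IsAttachment v = InTriangle v × ∃ λ w → ¬ InTriangle w × Adj G v w

  IsRimEnd : Fin N → Set
  IsRimEnd v = IsRim v × (∀ w w′ → IsRim w → IsRim w′ → Adj G v w → Adj G v w′ → w ≡ w′)

  data RimEndWithin : ℕ → Fin N → Set where
    here : ∀ {k v} → IsRimEnd v → RimEndWithin k v
    step : ∀ {k v w} → Adj G v w → IsRim w → RimEndWithin k w → RimEndWithin (suc k) v

  AttachmentNearRimEnd : ℕ → Set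
  AttachmentNearRimEnd k = ∃ λ a → IsAttachment a × IsRim a × RimEndWithin k a

inTriangle-invariant : Invariant InTriangle
inTriangle-invariant φ (a , b , va , vb , ab) =
  ⟦ φ ⟧ a , ⟦ φ ⟧ b , ≅-preserves φ va , ≅-preserves φ vb , ≅-preserves φ ab

isHub-invariant : Invariant IsHub
isHub-invariant φ (t , hub) = inTriangle-invariant φ t , onto φ λ w tw w≢v →
  ≅-preserves φ (hub w (reflect φ inTriangle-invariant tw) (w≢v ∘ cong ⟦ φ ⟧))

isRim-invariant : Invariant IsRim
isRim-invariant φ (t , ¬hub) = inTriangle-invariant φ t , ¬hub ∘ reflect φ isHub-invariant

isAttachment-invariant : Invariant IsAttachment
isAttachment-invariant φ (t , w , ¬tw , vw) =
  inTriangle-invariant φ t , ⟦ φ ⟧ w , ¬tw ∘ reflect φ inTriangle-invariant , ≅-preserves φ vw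

isRimEnd-invariant : Invariant IsRimEnd
isRimEnd-invariant φ (rim , unique) =
  isRim-invariant φ rim , onto φ λ w → onto φ λ w′ rw rw′ vw vw′ →
  cong ⟦ φ ⟧ (unique w w′ (reflect φ isRim-invariant rw) (reflect φ isRim-invariant rw′)
                          (≅-reflects φ vw) (≅-reflects φ vw′))

rimEndWithin-invariant : Invariant (λ G → RimEndWithin G k)
rimEndWithin-invariant φ (here end)        = here (isRimEnd-invariant φ end)
rimEndWithin-invariant φ (step vw rw near) =
  step (≅-preserves φ vw) (isRim-invariant φ rw) (rimEndWithin-invariant φ near)

attachmentNearRimEnd-invariant : ∀ {N N′} {G : Graph N} {G′ : Graph N′} →
  G ≅ G′ → AttachmentNearRimEnd G k → AttachmentNearRimEnd G′ k
attachmentNearRimEnd-invariant φ (a , att , rim , near) =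
  ⟦ φ ⟧ a , isAttachment-invariant φ att , isRim-invariant φ rim , rimEndWithin-invariant φ near

Consecutive : ℕ → ℕ → Set
Consecutive x y = y ≡ suc x ⊎ x ≡ suc y

no-consecutive-triangle : Consecutive x y → Consecutive x z → ¬ Consecutive y z
no-consecutive-triangle (inj₁ refl) (inj₁ refl) (inj₁ ())
no-consecutive-triangle (inj₁ refl) (inj₁ refl) (inj₂ ())
no-consecutive-triangle (inj₁ refl) (inj₂ refl) (inj₁ ())
no-consecutive-triangle (inj₁ refl) (inj₂ refl) (inj₂ ())
no-consecutive-triangle (inj₂ refl) (inj₁ refl) (inj₁ ())
no-consecutive-triangle (inj₂ refl) (inj₁ refl) (inj₂ ())
no-consecutive-triangle (inj₂ refl) (inj₂ refl) (inj₁ ())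
no-consecutive-triangle (inj₂ refl) (inj₂ refl) (inj₂ ())

module FanWithTail (M N i : ℕ) where

  data Edge : ℕ → ℕ → Set where
    rim   : 1 ≤ a → suc a < M → Edge a (suc a)
    spoke : 1 ≤ b → b < M → Edge 0 b
    tail₀ : b ≡ M → Edge 0 b
    tail  : M ≤ a → suc a < N → Edge a (suc a)
    tail₁ : suc a ≡ N → b ≡ i → Edge a b

  Link : ℕ → ℕ → Set
  Link a b = Edge a b ⊎ Edge b a

  graph : Graph N
  graph .Adj u v = Link (toℕ u) (toℕ v)

⌊⌋-reflects : ∀ {A : Set} (a? : Dec A) → Reflects A ⌊ a? ⌋
⌊⌋-reflects (yes a) = ofʸ a
⌊⌋-reflects (no ¬a) = ofⁿ ¬a

≤pred⇒< : 0 < a → a ≤ pred x → a < x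
≤pred⇒< {x = zero}  0<a a≤0   = ⊥-elim (<⇒≱ 0<a a≤0)
≤pred⇒< {x = suc _} _   a≤x-1 = s≤s a≤x-1

≡pred⇒suc≡ : a < x → a ≡ pred x → suc a ≡ x
≡pred⇒suc≡ {x = suc _} _ a≡x-1 = cong suc a≡x-1

module _ (m n i : ℕ) where

  private
    M N : ℕ
    M = 2 * m
    N = 2 * m + (n ∸ 2)

  open FanWithTail M N i

  RawEdge : ℕ → ℕ → Set
  RawEdge a b = ((1 ≤ a × a < M ∸ 1 × b ≡ suc a) ⊎ (a ≡ 0 × 1 ≤ b × b < M))
              ⊎ (a ≡ 0 × b ≡ M) ⊎ (M ≤ a × suc a < N × b ≡ suc a) ⊎ (a ≡ N ∸ 1 × b ≡ i)

  hEdge-reflects : ∀ a b → Reflects (RawEdge a b) (hEdge m n i a b)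
  hEdge-reflects a b =
    (  (r (1 ≤? a) ×-reflects r (a <? M ∸ 1) ×-reflects r (b ≟ suc a))
    ⊎-reflects (r (a ≟ 0) ×-reflects r (1 ≤? b) ×-reflects r (b <? M)))
    ⊎-reflects (r (a ≟ 0) ×-reflects r (b ≟ M))
    ⊎-reflects (r (M ≤? a) ×-reflects r (suc a <? N) ×-reflects r (b ≟ suc a))
    ⊎-reflects (r (a ≟ N ∸ 1) ×-reflects r (b ≟ i))
    where r = ⌊⌋-reflects

  raw⇒edge : a < N → RawEdge a b → Edge a b
  raw⇒edge _   (inj₁ (inj₁ (1≤a , a<M-1 , refl)))          = rim 1≤a (≤pred⇒< (s≤s z≤n) a<M-1)
  raw⇒edge _   (inj₁ (inj₂ (refl , 1≤b , b<M)))            = spoke 1≤b b<M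
  raw⇒edge _   (inj₂ (inj₁ (refl , b≡M)))                  = tail₀ b≡M
  raw⇒edge _   (inj₂ (inj₂ (inj₁ (M≤a , a+1<N , refl))))  = tail M≤a a+1<N
  raw⇒edge a<N (inj₂ (inj₂ (inj₂ (a≡N-1 , b≡i))))          = tail₁ (≡pred⇒suc≡ a<N a≡N-1) b≡i

  edge⇒raw : Edge a b → RawEdge a b
  edge⇒raw (rim 1≤a a+1<M)   = inj₁ (inj₁ (1≤a , suc[m]≤n⇒m≤pred[n] a+1<M , refl))
  edge⇒raw (spoke 1≤b b<M)   = inj₁ (inj₂ (refl , 1≤b , b<M))
  edge⇒raw (tail₀ b≡M)       = inj₂ (inj₁ (refl , b≡M))
  edge⇒raw (tail M≤a a+1<N)  = inj₂ (inj₂ (inj₁ (M≤a , a+1<N , refl)))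
  edge⇒raw (tail₁ a+1≡N b≡i) = inj₂ (inj₂ (inj₂ (cong pred a+1≡N , b≡i)))

  H≅fanWithTail : H m n i ≅ graph
  H≅fanWithTail = record
    { bij       = ↔-id _
    ; preserves = λ u v uv → Sum.map (raw⇒edge (toℕ<n u)) (raw⇒edge (toℕ<n v))
                               (invert (subst (Reflects _) uv (adj-reflects u v)))
    ; reflects  = λ u v uv → det (adj-reflects u v) (ofʸ (Sum.map edge⇒raw edge⇒raw uv))
    }
    where
    adj-reflects : ∀ u v → Reflects (RawEdge (toℕ u) (toℕ v) ⊎ RawEdge (toℕ v) (toℕ u))
                                 (hEdge m n i (toℕ u) (toℕ v) ∨ hEdge m n i (toℕ v) (toℕ u))
    adj-reflects u v = hEdge-reflects (toℕ u) (toℕ v) ⊎-reflects hEdge-reflects (toℕ v) (toℕ u)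

-- k < x − 1 and k < M − 1 − x: more than k steps from both rim ends 1 and M − 1.
FarFromRimEnds : ℕ → ℕ → ℕ → Set
FarFromRimEnds M k x = 2 + k ≤ x × 2 + x + k ≤ M

far-step : ∀ {M} → FarFromRimEnds M (suc k) x → Consecutive x y → FarFromRimEnds M k y
far-step {k} {x} {M = M} (lo , hi) (inj₁ refl) =
  m≤n⇒m≤1+n (≤-trans (n≤1+n _) lo) , subst (λ z → 2 + z ≤ M) (+-suc x k) hi
far-step {k} (lo , hi) (inj₂ refl) =
  s≤s⁻¹ lo , ≤-trans (+-mono-≤ (n≤1+n _) (n≤1+n k)) hi

module FanWithTailProperties
  (M N i : ℕ) (3<M : 3 < M) (M+1<N : suc M < N) (1≤i : 1 ≤ i) (i<M : i < M) where

  open FanWithTail M N i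

  private
    0<M : 0 < M
    0<M = ≤-trans (s≤s z≤n) 3<M
    1<M : 1 < M
    1<M = ≤-trans (s≤s (s≤s z≤n)) 3<M
    2<M : 2 < M
    2<M = ≤-trans (s≤s (s≤s (s≤s z≤n))) 3<M
    M<N : M < N
    M<N = <-trans (n<1+n M) M+1<N

  fan-not-last : a < M → suc a ≢ N
  fan-not-last a<M a+1≡N = <-irrefl a+1≡N (≤-<-trans a<M M<N)

  edge-irrefl : ¬ Edge a a
  edge-irrefl (spoke () _)
  edge-irrefl (tail₀ 0≡M) = <-irrefl 0≡M 0<M
  edge-irrefl (tail₁ a+1≡N refl) = fan-not-last i<M a+1≡N

  link-irrefl : ¬ Link a a
  link-irrefl (inj₁ aa) = edge-irrefl aa
  link-irrefl (inj₂ aa) = edge-irrefl aa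

  rim-edge : 1 ≤ a → a < M → b < M → Edge a b → b ≡ suc a
  rim-edge _  _   _   (rim _ _)       = refl
  rim-edge () _   _   (spoke _ _)
  rim-edge _  _   b<M (tail₀ refl)    = ⊥-elim (<-irrefl refl b<M)
  rim-edge _  a<M _   (tail M≤a _)    = ⊥-elim (<⇒≱ a<M M≤a)
  rim-edge _  a<M _   (tail₁ a+1≡N _) = ⊥-elim (fan-not-last a<M a+1≡N)

  tail-edge : M ≤ a → Edge a b → b ≡ suc a ⊎ (suc a ≡ N × b ≡ i)
  tail-edge M≤a (rim _ a+1<M)      = ⊥-elim (<⇒≱ (<-trans (n<1+n _) a+1<M) M≤a)
  tail-edge M≤0 (spoke _ _)        = ⊥-elim (<⇒≱ 0<M M≤0)
  tail-edge M≤0 (tail₀ _)          = ⊥-elim (<⇒≱ 0<M M≤0)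
  tail-edge _   (tail _ _)         = inj₁ refl
  tail-edge _   (tail₁ a+1≡N b≡i)  = inj₂ (a+1≡N , b≡i)

  edge-into-tail : a < M → M ≤ b → Edge a b → a ≡ 0 × b ≡ M
  edge-into-tail _   M≤b (rim _ b<M)   = ⊥-elim (<⇒≱ b<M M≤b)
  edge-into-tail _   M≤b (spoke _ b<M) = ⊥-elim (<⇒≱ b<M M≤b)
  edge-into-tail _   _   (tail₀ b≡M)   = refl , b≡M
  edge-into-tail a<M _   (tail M≤a _)  = ⊥-elim (<⇒≱ a<M M≤a)
  edge-into-tail _   M≤i (tail₁ _ refl) = ⊥-elim (<⇒≱ i<M M≤i)

  rim-link : 1 ≤ a → a < M → 1 ≤ b → b < M → Link a b → Consecutive a b
  rim-link 1≤a a<M _   b<M (inj₁ ab) = inj₁ (rim-edge 1≤a a<M b<M ab)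
  rim-link _   a<M 1≤b b<M (inj₂ ba) = inj₂ (rim-edge 1≤b b<M a<M ba)

  tail-link : M ≤ a → M ≤ b → Link a b → Consecutive a b
  tail-link M≤a M≤b (inj₁ ab) with tail-edge M≤a ab
  ... | inj₁ b≡a+1      = inj₁ b≡a+1
  ... | inj₂ (_ , refl) = ⊥-elim (<⇒≱ i<M M≤b)
  tail-link M≤a M≤b (inj₂ ba) with tail-edge M≤b ba
  ... | inj₁ a≡b+1      = inj₂ a≡b+1
  ... | inj₂ (_ , refl) = ⊥-elim (<⇒≱ i<M M≤a)

  crossing : a < M → M ≤ b → Link a b → (a ≡ 0 × b ≡ M) ⊎ (a ≡ i × suc b ≡ N)
  crossing a<M M≤b (inj₁ ab) = inj₁ (edge-into-tail a<M M≤b ab)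
  crossing a<M M≤b (inj₂ ba) with tail-edge M≤b ba
  ... | inj₁ refl              = ⊥-elim (<⇒≱ a<M (m≤n⇒m≤1+n M≤b))
  ... | inj₂ (b+1≡N , a≡i)     = inj₂ (a≡i , b+1≡N)

  tail-neighbour-unique : a < M → M ≤ b → M ≤ z → Link a b → Link a z → b ≡ z
  tail-neighbour-unique a<M M≤b M≤z ab az with crossing a<M M≤b ab | crossing a<M M≤z az
  ... | inj₁ (_ , refl)   | inj₁ (_ , refl)   = refl
  ... | inj₁ (refl , _)   | inj₂ (0≡i , _)    = ⊥-elim (<-irrefl 0≡i 1≤i)
  ... | inj₂ (refl , _)   | inj₁ (i≡0 , _)    = ⊥-elim (<-irrefl (sym i≡0) 1≤i)
  ... | inj₂ (_ , b+1≡N)  | inj₂ (_ , z+1≡N)  = suc-injective (trans b+1≡N (sym z+1≡N))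

  tail-triangle-free : M ≤ x → Link x a → Link x b → ¬ Link a b
  tail-triangle-free {x} {a} {b} M≤x xa xb ab with M ≤? a | M ≤? b
  ... | yes M≤a | yes M≤b =
    no-consecutive-triangle (tail-link M≤x M≤a xa) (tail-link M≤x M≤b xb) (tail-link M≤a M≤b ab)
  ... | no M≰a  | yes M≤b =
    link-irrefl (subst (Link x) (sym (tail-neighbour-unique (≰⇒> M≰a) M≤x M≤b (swap xa) ab)) xb)
  ... | yes M≤a | no M≰b  =
    link-irrefl
      (subst (Link x) (sym (tail-neighbour-unique (≰⇒> M≰b) M≤x M≤a (swap xb) (swap ab))) xa)
  ... | no M≰a  | no M≰b  with crossing (≰⇒> M≰a) M≤x (swap xa) | crossing (≰⇒> M≰b) M≤x (swap xb)
  ...   | inj₁ (refl , _)   | inj₁ (refl , _)    = link-irrefl ab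
  ...   | inj₂ (refl , _)   | inj₂ (refl , _)    = link-irrefl ab
  ...   | inj₁ (_ , refl)   | inj₂ (_ , M+1≡N)   = <-irrefl M+1≡N M+1<N
  ...   | inj₂ (_ , M+1≡N)  | inj₁ (_ , refl)    = <-irrefl M+1≡N M+1<N

  fan-vertex : x < M → Fin N
  fan-vertex x<M = fromℕ< (<-trans x<M M<N)

  toℕ-fan-vertex : (x<M : x < M) → toℕ (fan-vertex x<M) ≡ x
  toℕ-fan-vertex _ = toℕ-fromℕ< _

  adj-by-labels : ∀ {u v} → toℕ u ≡ x → toℕ v ≡ y → Link x y → Adj graph u v
  adj-by-labels refl refl xy = xy

  fan-triangle : x < M → ∃₂ λ y z → y < M × z < M × Link x y × Link x z × Link y z
  fan-triangle {zero} _ =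
    1 , 2 , 1<M , 2<M ,
    inj₁ (spoke (s≤s z≤n) 1<M) , inj₁ (spoke (s≤s z≤n) 2<M) , inj₁ (rim (s≤s z≤n) 2<M)
  fan-triangle {suc zero} _ =
    0 , 2 , 0<M , 2<M ,
    inj₂ (spoke (s≤s z≤n) 1<M) , inj₁ (rim (s≤s z≤n) 2<M) , inj₁ (spoke (s≤s z≤n) 2<M)
  fan-triangle {suc (suc x)} x+2<M =
    0 , suc x , 0<M , x+1<M ,
    inj₂ (spoke (s≤s z≤n) x+2<M) , inj₂ (rim (s≤s z≤n) x+2<M) , inj₁ (spoke (s≤s z≤n) x+1<M)
    where
    x+1<M : suc x < M
    x+1<M = <-trans (n<1+n _) x+2<M

  fan⇒inTriangle : ∀ {v} → toℕ v ≡ x → x < M → InTriangle graph v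
  fan⇒inTriangle v≡x x<M with fan-triangle x<M
  ... | y , z , y<M , z<M , xy , xz , yz =
    fan-vertex y<M , fan-vertex z<M ,
    adj-by-labels v≡x (toℕ-fan-vertex y<M) xy ,
    adj-by-labels v≡x (toℕ-fan-vertex z<M) xz ,
    adj-by-labels (toℕ-fan-vertex y<M) (toℕ-fan-vertex z<M) yz

  inTriangle⇒fan : ∀ {v} → InTriangle graph v → toℕ v < M
  inTriangle⇒fan {v} (a , b , va , vb , ab) with M ≤? toℕ v
  ... | yes M≤v = ⊥-elim (tail-triangle-free M≤v va vb ab)
  ... | no M≰v  = ≰⇒> M≰v

  ¬inTriangle⇒tail : ∀ {v} → ¬ InTriangle graph v → M ≤ toℕ v
  ¬inTriangle⇒tail ¬tv = ≮⇒≥ (¬tv ∘ fan⇒inTriangle refl)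

  hub-zero : ∀ {v} → toℕ v ≡ 0 → IsHub graph v
  hub-zero {v} v≡0 = fan⇒inTriangle v≡0 0<M , λ w tw w≢v →
    adj-by-labels v≡0 refl (inj₁ (spoke (n≢0⇒n>0 (w≢v ∘ w≡0⇒w≡v)) (inTriangle⇒fan tw)))
    where
    w≡0⇒w≡v : ∀ {w} → toℕ w ≡ 0 → w ≡ v
    w≡0⇒w≡v w≡0 = toℕ-injective (trans w≡0 (sym v≡0))

  rim⇒range : ∀ {v} → IsRim graph v → 1 ≤ toℕ v × toℕ v < M
  rim⇒range (t , ¬hub) = n≢0⇒n>0 (¬hub ∘ hub-zero) , inTriangle⇒fan t

  rim-adjacent : ∀ {v w} → IsRim graph v → IsRim graph w → Adj graph v w →
                 Consecutive (toℕ v) (toℕ w)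
  rim-adjacent rv rw =
    let 1≤v , v<M = rim⇒range rv
        1≤w , w<M = rim⇒range rw
    in  rim-link 1≤v v<M 1≤w w<M

  non-consecutive-rim-label : 1 ≤ x → x < M → 3 ≤ x ⊎ 2 + x < M →
                              ∃ λ y → 1 ≤ y × y < M × y ≢ x × ¬ Consecutive x y
  non-consecutive-rim-label 1≤x x<M (inj₁ 3≤x) =
    1 , s≤s z≤n , 1<M , <⇒≢ (≤-trans (s≤s (s≤s z≤n)) 3≤x) , λ where
      (inj₁ 1≡x+1) → <-irrefl (suc-injective 1≡x+1) 1≤x
      (inj₂ x≡2)   → <-irrefl (sym x≡2) 3≤x
  non-consecutive-rim-label 1≤x x<M (inj₂ x+2<M) = 2 + _ , s≤s z≤n , x+2<M , (λ ()) , λ where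
      (inj₁ ())
      (inj₂ ())

  -- The side condition only excludes x = 2 when M = 4: that vertex is adjacent to every
  -- other fan vertex, hence a hub.
  range⇒rim : ∀ {v} → toℕ v ≡ x → 1 ≤ x → x < M → 3 ≤ x ⊎ 2 + x < M → IsRim graph v
  range⇒rim {v = v} refl 1≤v v<M far = fan⇒inTriangle refl v<M , ¬hub
    where
    ¬hub : ¬ IsHub graph v
    ¬hub (_ , hub) with non-consecutive-rim-label 1≤v v<M far
    ... | y , 1≤y , y<M , y≢v , ¬consecutive = ¬consecutive (rim-link 1≤v v<M 1≤y y<M
      (subst (Link (toℕ v)) (toℕ-fan-vertex y<M)
        (hub (fan-vertex y<M) (fan⇒inTriangle (toℕ-fan-vertex y<M) y<M)
             (y≢v ∘ trans (sym (toℕ-fan-vertex y<M)) ∘ cong toℕ))))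

  attached-rim-label : ∀ {v} → IsAttachment graph v → IsRim graph v → toℕ v ≡ i
  attached-rim-label (t , w , ¬tw , vw) rv
    with crossing (inTriangle⇒fan t) (¬inTriangle⇒tail ¬tw) vw
  ... | inj₁ (v≡0 , _) = ⊥-elim (<-irrefl (sym v≡0) (proj₁ (rim⇒range rv)))
  ... | inj₂ (v≡i , _) = v≡i

  attachment-at-i : ∀ {v} → toℕ v ≡ i → IsAttachment graph v
  attachment-at-i v≡i =
    fan⇒inTriangle v≡i i<M , last , ¬inTriangle-last ,
    adj-by-labels v≡i (toℕ-fromℕ< _) (inj₂ (tail₁ (suc-pred N) refl))
    where
    instance
      N-nonZero : NonZero N
      N-nonZero = >-nonZero (<-trans 0<M M<N)
    last : Fin N
    last = fromℕ< (≤-reflexive (suc-pred N))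
    ¬inTriangle-last : ¬ InTriangle graph last
    ¬inTriangle-last t = <⇒≱ (inTriangle⇒fan t)
      (subst (M ≤_) (sym (toℕ-fromℕ< _)) (<⇒≤ (suc[m]≤n⇒m≤pred[n] M+1<N)))

  final-rim-end : ∀ {v} → toℕ v ≡ x → suc x ≡ M → 3 ≤ x → IsRimEnd graph v
  final-rim-end {x} {v} v≡x x+1≡M 3≤x = rv , λ w w′ rw rw′ vw vw′ →
      toℕ-injective (suc-injective (trans (predecessor rw vw) (sym (predecessor rw′ vw′))))
    where
    rv : IsRim graph v
    rv = range⇒rim v≡x (≤-trans (s≤s z≤n) 3≤x) (subst (x <_) x+1≡M (n<1+n x)) (inj₁ 3≤x)
    predecessor : ∀ {w} → IsRim graph w → Adj graph v w → suc (toℕ w) ≡ x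
    predecessor rw vw with rim-adjacent rv rw vw
    ... | inj₁ w≡v+1 =
      ⊥-elim (<-irrefl (trans w≡v+1 (trans (cong suc v≡x) x+1≡M)) (proj₂ (rim⇒range rw)))
    ... | inj₂ v≡w+1 = trans (sym v≡w+1) v≡x

  inner-rim-not-end : ∀ {v} → toℕ v ≡ suc x → 1 ≤ x → 2 + x < M → ¬ IsRimEnd graph v
  inner-rim-not-end {x} v≡x+1 1≤x x+2<M (_ , unique) = x≢x+2
    (trans (sym (toℕ-fan-vertex x<M))
      (trans (cong toℕ (unique below above rim-below rim-above v-below v-above))
        (toℕ-fan-vertex x+2<M)))
    where
    x≢x+2 : x ≢ 2 + x
    x≢x+2 ()
    x+1<M : suc x < M
    x+1<M = <-trans (n<1+n _) x+2<M
    x<M : x < M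
    x<M = <-trans (n<1+n _) x+1<M
    below above : Fin N
    below = fan-vertex x<M
    above = fan-vertex x+2<M
    rim-below : IsRim graph below
    rim-below = range⇒rim (toℕ-fan-vertex x<M) 1≤x x<M (inj₂ x+2<M)
    rim-above : IsRim graph above
    rim-above = range⇒rim (toℕ-fan-vertex x+2<M) (s≤s z≤n) x+2<M (inj₁ (s≤s (s≤s 1≤x)))
    v-below : Adj graph _ below
    v-below = adj-by-labels v≡x+1 (toℕ-fan-vertex x<M) (inj₂ (rim 1≤x x+1<M))
    v-above : Adj graph _ above
    v-above = adj-by-labels v≡x+1 (toℕ-fan-vertex x+2<M) (inj₁ (rim (s≤s z≤n) x+2<M))

  near-rim-end : ∀ {v} → toℕ v ≡ x → suc (x + k) ≡ M → 3 ≤ x → RimEndWithin graph k v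
  near-rim-end {x} {zero} v≡x x+0+1≡M 3≤x =
    here (final-rim-end v≡x (trans (cong suc (sym (+-identityʳ x))) x+0+1≡M) 3≤x)
  near-rim-end {x} {suc k} v≡x x+k+2≡M 3≤x =
    step (adj-by-labels v≡x (toℕ-fan-vertex x+1<M) (inj₁ (rim (≤-trans (s≤s z≤n) 3≤x) x+1<M)))
         (range⇒rim (toℕ-fan-vertex x+1<M) (s≤s z≤n) x+1<M (inj₁ (m≤n⇒m≤1+n 3≤x)))
         (near-rim-end (toℕ-fan-vertex x+1<M) x+1+k+1≡M (m≤n⇒m≤1+n 3≤x))
    where
    x+1+k+1≡M : suc (suc x + k) ≡ M
    x+1+k+1≡M = trans (cong suc (sym (+-suc x k))) x+k+2≡M
    x+1<M : suc x < M
    x+1<M = subst (2 + x ≤_) x+1+k+1≡M (s≤s (m≤m+n (suc x) k))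

  far-from-rim-end : ∀ {v} → RimEndWithin graph k v → IsRim graph v → toℕ v ≡ x →
                     ¬ FarFromRimEnds M k x
  far-from-rim-end (here end) _ v≡x+1 (s≤s 1+k≤x , x+k+3≤M) =
    inner-rim-not-end v≡x+1 (≤-trans (s≤s z≤n) 1+k≤x) (≤-trans (m≤m+n _ _) x+k+3≤M) end
  far-from-rim-end (step vw rw near) rv refl far =
    far-from-rim-end near rw refl (far-step far (rim-adjacent rv rw vw))

  attachment-near-rim-end : 3 ≤ i → suc (i + k) ≡ M → AttachmentNearRimEnd graph k
  attachment-near-rim-end 3≤i i+k+1≡M =
    fan-vertex i<M , attachment-at-i label , range⇒rim label 1≤i i<M (inj₁ 3≤i) ,
    near-rim-end label i+k+1≡M 3≤i
    where
    label : toℕ (fan-vertex i<M) ≡ i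
    label = toℕ-fan-vertex i<M

  no-attachment-near-rim-end : FarFromRimEnds M k i → ¬ AttachmentNearRimEnd graph k
  no-attachment-near-rim-end far (a , att , ra , near) =
    far-from-rim-end near ra (attached-rim-label att ra) far

attachment-far-from-rim-ends : ∀ {m i j} → m ≤ i → i < j → suc (j + k) ≡ 2 * m →
                               FarFromRimEnds (2 * m) k i
attachment-far-from-rim-ends {k} {m} {i} {j} m≤i i<j j+k+1≡2m = lo , hi
  where
  open ≤-Reasoning
  lo : 2 + k ≤ i
  lo = +-cancelʳ-≤ j (2 + k) i (begin
    2 + k + j    ≡⟨ cong (2 +_) (+-comm k j) ⟩
    2 + (j + k)  ≡⟨ cong suc j+k+1≡2m ⟩
    suc (2 * m)  ≡⟨ cong (λ z → suc (m + z)) (+-identityʳ m) ⟩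
    suc (m + m)  ≤⟨ +-mono-≤-< m≤i (≤-<-trans m≤i i<j) ⟩
    i + j        ∎)
  hi : 2 + i + k ≤ 2 * m
  hi = subst (2 + i + k ≤_) j+k+1≡2m (s≤s (+-monoˡ-≤ k i<j))

H-non-isomorphic : ∀ {m n i j} → m ≤ i → i < j → j ≤ 2 * m ∸ 1 → 2 * m + 1 < n →
                   ¬ (H m n j ≅ H m n i)
H-non-isomorphic {m} {n} {i} {j} m≤i i<j j≤2m-1 2m+1<n φ =
  Fanᵢ.no-attachment-near-rim-end (attachment-far-from-rim-ends m≤i i<j j+d+1≡2m)
    (attachmentNearRimEnd-invariant (H≅fanWithTail m n i)
      (attachmentNearRimEnd-invariant φ
        (attachmentNearRimEnd-invariant (≅-sym (H≅fanWithTail m n j))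
          (Fanⱼ.attachment-near-rim-end 3≤j j+d+1≡2m))))
  where
  M N : ℕ
  M = 2 * m
  N = 2 * m + (n ∸ 2)
  j<M : j < M
  j<M = ≤pred⇒< (≤-<-trans z≤n i<j) j≤2m-1
  d : ℕ
  d = M ∸ suc j
  j+d+1≡2m : suc (j + d) ≡ M
  j+d+1≡2m = m+[n∸m]≡n j<M
  2≤m : 2 ≤ m
  2≤m = +-cancelʳ-≤ m 2 m (subst (2 + m ≤_) (cong (m +_) (+-identityʳ m))
          (≤-trans (s≤s (≤-<-trans m≤i i<j)) j<M))
  3<M : 3 < M
  3<M = *-monoʳ-≤ 2 2≤m
  M+1<N : suc M < N
  M+1<N = subst (_< N) (+-comm M 1)
    (+-monoʳ-< M (∸-monoˡ-≤ 2 (≤-trans (≤-trans 3<M (m≤m+n M 1)) (<⇒≤ 2m+1<n))))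
  2≤i : 2 ≤ i
  2≤i = ≤-trans 2≤m m≤i
  3≤j : 3 ≤ j
  3≤j = ≤-trans (s≤s 2≤i) i<j
  module Fanᵢ = FanWithTailProperties M N i 3<M M+1<N (≤-trans (s≤s z≤n) 2≤i) (<-trans i<j j<M)
  module Fanⱼ = FanWithTailProperties M N j 3<M M+1<N (≤-trans (s≤s z≤n) 3≤j) j<M

theorem5p1 : (m n : ℕ) → 1 ≤ m → 2 * m + 1 < n →
    (i j : ℕ) → m ≤ i → i ≤ 2 * m ∸ 1 → m ≤ j → j ≤ 2 * m ∸ 1 →
    H m n i ≅ H m n j → i ≡ j
theorem5p1 m n _ 2m+1<n i j m≤i i≤2m-1 m≤j j≤2m-1 φ with <-cmp i j
... | tri< i<j _ _ = ⊥-elim (H-non-isomorphic m≤i i<j j≤2m-1 2m+1<n (≅-sym φ))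
... | tri≈ _ i≡j _ = i≡j
... | tri> _ _ j<i = ⊥-elim (H-non-isomorphic m≤j j<i i≤2m-1 2m+1<n φ)
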